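{- Let $b \ge 3$ and $m \ge 3$ be integers. Then $D(b) - D(b-1)$ equals one plus the number of digits $d$ with $0 < d < b-1$ such that the base-$b$ comma sequence with initial value $\{0,d\}_b = b^m - b^2 + d$ has no term $\ge b^m$ (i.e. fails to escape the interval $[b^m - b^2, b^m)$).
   Context: Base-$b$ generalized comma sequence with initial value $v \ge 1$: $a(1)=v$, and for $n>1$, with $x$ the least significant base-$b$ digit of $a(n-1)$, $a(n)=a(n-1)+bx+y$ where $y\in\{0,\dots,b-1\}$ must equal the most significant base-$b$ digit of $a(n)$ and is the smallest such; if none exists the sequence terminates. For $b \ge 2$, $D(b)$ denotes the number of positive integers $v \in [b^m - b^2, b^m)$ (for any fixed $m \ge 3$; this number does not depend on $m$) such that no term of the base-$b$ comma sequence with initial value $v$ is $\ge b^m$. The notation $\{x,y\}_b$ denotes the integer in $[b^m-b^2,b^m)$ with last two base-$b$ digits $x,y$, i.e. $b^m - b^2 + xb + y$. -}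

module Defs where

open import Data.Nat using (ℕ; zero; suc; _+_; _*_; _∸_; _^_; _≤_; _<_; _≥_)
open import Data.Product using (Σ; ∃; _×_; _,_)
open import Data.Sum using (_⊎_)
open import Relation.Nullary using (¬_)
open import Relation.Binary.PropositionalEquality using (_≡_)

IsLSD : ℕ → ℕ → ℕ → Set
IsLSD b a x = x < b × ∃ λ q → a ≡ q * b + x

IsMSD : ℕ → ℕ → ℕ → Set
IsMSD b a y =
  (a ≡ 0 × y ≡ 0)
  ⊎ (1 ≤ y × y < b × ∃ λ k → y * b ^ k ≤ a × a < suc y * b ^ k)

-- If no such y exists there is no step (the sequence terminates).
Step : ℕ → ℕ → ℕ → Set
Step b a a' = Σ ℕ λ x → Σ ℕ λ y →
  IsLSD b a x
  × y < b
  × IsMSD b (a + b * x + y) y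
  × (∀ y' → y' < y → ¬ IsMSD b (a + b * x + y') y')
  × a' ≡ a + b * x + y

-- Term b v n a : the n-th term (0-indexed, i.e. a(n+1)) of the base-b comma
-- sequence with initial value v exists and equals a.
data Term (b v : ℕ) : ℕ → ℕ → Set where
  start : Term b v 0 v
  next  : ∀ {n a a'} → Term b v n a → Step b a a' → Term b v (suc n) a'

NoEscape : ℕ → ℕ → ℕ → Set
NoEscape b m v = ∀ n a → Term b v n a → a < b ^ m

data CountRange (P : ℕ → Set) (lo : ℕ) : ℕ → ℕ → Set where
  nil : CountRange P lo 0 0
  yes : ∀ {len c} → P (lo + len) → CountRange P lo len c
        → CountRange P lo (suc len) (suc c)
  no  : ∀ {len c} → ¬ P (lo + len) → CountRange P lo len c
        → CountRange P lo (suc len) c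

-- D b m c : c is the number of positive v ∈ [b^m - b^2, b^m) such that the
-- base-b comma sequence with initial value v has no term ≥ b^m  (D(b), computed at m).
Dcount : ℕ → ℕ → ℕ → Set
Dcount b m c = CountRange (λ v → 1 ≤ v × NoEscape b m v) (b ^ m ∸ b ^ 2) (b ^ 2) c

brace : ℕ → ℕ → ℕ → ℕ → ℕ
brace b m x y = b ^ m ∸ b ^ 2 + x * b + y

module Submission where

-- Inside the window [b^m - b², b^m) every value has leading digit b - 1, and just above it the
-- leading digit is 1.  Hence from {x,y}_b the sequence moves to {x+y+1, y-1}_b while
-- x + y < b - 1 and y > 0, escapes at once if x + y ≥ b or (x, y) = (0, b-1), escapes one step
-- later if y = 0, and halts inside the window if x + y = b - 1 with x, y ≥ 1.  Whether {x,y}_b is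
-- trapped therefore depends only on u = b - 1 - x, on y, and on whether x = 0.  So row x + 1
-- of base b and row x of base b - 1 agree for x ≥ 1; the difference D(b) - D(b-1) consists of
-- the trapped cells {0,d}_b of row 0 of base b, plus the diagonal cell y = u, which is trapped in
-- row 1 of base b but not in row 0 of base b - 1.

open import Defs
open import Data.Nat using (ℕ; zero; suc; _+_; _*_; _∸_; _^_; _≤_; _<_; _≥_)
open import Data.Product using (Σ; ∃; _×_; _,_)
open import Relation.Binary.PropositionalEquality using (_≡_)

open import Data.Bool.Base using (Bool; true; false; if_then_else_)
open import Data.Empty using (⊥-elim)
open import Data.Nat using (z≤n; s≤s; _<ᵇ_; compare; less; equal; greater)
open import Data.Nat.DivMod using (_%_; [m+kn]%n≡m%n; m<n⇒m%n≡m)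
open import Data.Nat.Properties
open import Algebra.Properties.CommutativeSemigroup +-commutativeSemigroup using (x∙yz≈y∙xz; xy∙z≈x∙zy)
open import Data.Nat.Tactic.RingSolver using (solve-∀)
open import Data.Sum using (inj₁; inj₂)
open import Function using (_∘_)
open import Relation.Binary.Definitions using (tri<; tri≈; tri>)
open import Relation.Binary.PropositionalEquality
  using (refl; sym; trans; cong; cong₂; subst; subst₂; module ≡-Reasoning)
open import Relation.Nullary using (¬_)
open import Relation.Nullary.Reflects using (Reflects; ofʸ; ofⁿ; _×-reflects_)

Term-cons : ∀ {b v a₁ n a} → Step b v a₁ → Term b a₁ n a → Term b v (suc n) a
Term-cons st start      = next start st
Term-cons st (next t s) = next (Term-cons st t) s

Term-uncons : ∀ {b v n a} → Term b v (suc n) a → ∃ λ a₁ → Step b v a₁ × Term b a₁ n a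
Term-uncons (next start st) = _ , st , start
Term-uncons (next (next t s) st) with Term-uncons (next t s)
... | a₁ , st₁ , t₁ = a₁ , st₁ , next t₁ st

noEscape-halt : ∀ {b m v} → v < b ^ m → (∀ a → ¬ Step b v a) → NoEscape b m v
noEscape-halt v<bᵐ halts zero    _ start = v<bᵐ
noEscape-halt v<bᵐ halts (suc n) a t with Term-uncons t
... | a₁ , st , _ = ⊥-elim (halts a₁ st)

noEscape-advance : ∀ {b m v w β} → v < b ^ m → Step b v w → (∀ a → Step b v a → a ≡ w) →
                   Reflects (NoEscape b m w) β → Reflects (NoEscape b m v) β
noEscape-advance {b} {m} {v} v<bᵐ st det (ofʸ w-stays) = ofʸ v-stays
  where
  v-stays : NoEscape b m v
  v-stays zero    _ start = v<bᵐ
  v-stays (suc n) a t with Term-uncons t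
  ... | a₁ , st₁ , t₁ = w-stays n a (subst (λ u → Term b u n a) (det a₁ st₁) t₁)
noEscape-advance v<bᵐ st det (ofⁿ w-escapes) =
  ofⁿ λ v-stays → w-escapes λ n a t → v-stays (suc n) a (Term-cons st t)

escape-now : ∀ {b m v a} → Step b v a → b ^ m ≤ a → ¬ NoEscape b m v
escape-now {a = a} st bᵐ≤a v-stays = <⇒≱ (v-stays 1 a (next start st)) bᵐ≤a

msd-positive : ∀ {b n y} → 1 ≤ n → IsMSD b n y →
               1 ≤ y × y < b × ∃ λ k → y * b ^ k ≤ n × n < suc y * b ^ k
msd-positive () (inj₁ (refl , _))
msd-positive _  (inj₂ msd) = msd

msd-nonzero : ∀ {b n} → 1 ≤ n → ¬ IsMSD b n 0
msd-nonzero 1≤n msd with msd-positive 1≤n msd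
... | () , _

msd-power-bracket : ∀ {b₁ n y} k → 1 ≤ y → y < suc b₁ → y * suc b₁ ^ k ≤ n → n < suc y * suc b₁ ^ k →
                    suc b₁ ^ k ≤ n × n < suc b₁ ^ suc k
msd-power-bracket {b₁} k 1≤y y<b lo hi =
  ≤-trans (≤-reflexive (sym (*-identityˡ (suc b₁ ^ k)))) (≤-trans (*-monoˡ-≤ (suc b₁ ^ k) 1≤y) lo) ,
  <-≤-trans hi (*-monoˡ-≤ (suc b₁ ^ k) y<b)

power-bracket-unique : ∀ {b₁ n} k j → suc b₁ ^ k ≤ n → n < suc b₁ ^ suc k →
                       suc b₁ ^ j ≤ n → n < suc b₁ ^ suc j → k ≡ j
power-bracket-unique {b₁} k j loₖ hiₖ loⱼ hiⱼ with <-cmp k j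
... | tri< k<j _ _ = ⊥-elim (<⇒≱ hiₖ (≤-trans (^-monoʳ-≤ (suc b₁) k<j) loⱼ))
... | tri≈ _ k≡j _ = k≡j
... | tri> _ _ j<k = ⊥-elim (<⇒≱ hiⱼ (≤-trans (^-monoʳ-≤ (suc b₁) j<k) loₖ))

msd-unique : ∀ {b₁ n y z} → 1 ≤ n → IsMSD (suc b₁) n y → IsMSD (suc b₁) n z → y ≡ z
msd-unique {b₁} {n} {y} {z} 1≤n msd-y msd-z
  with msd-positive 1≤n msd-y | msd-positive 1≤n msd-z
... | 1≤y , y<b , k , loy , hiy | 1≤z , z<b , j , loz , hiz
  with msd-power-bracket k 1≤y y<b loy hiy | msd-power-bracket j 1≤z z<b loz hiz
... | loₖ , hiₖ | loⱼ , hiⱼ with power-bracket-unique k j loₖ hiₖ loⱼ hiⱼ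
... | refl = ≤-antisym (≤-pred (*-cancelʳ-< _ y (suc z) (≤-<-trans loy hiz)))
                       (≤-pred (*-cancelʳ-< _ z (suc y) (≤-<-trans loz hiy)))

lsd-unique : ∀ {b₁ a x y} → IsLSD (suc b₁) a x → IsLSD (suc b₁) a y → x ≡ y
lsd-unique {b₁} {x = x} {y} (x<b , q , refl) (y<b , r , eq) = begin
  x                                 ≡⟨ sym (m<n⇒m%n≡m x<b) ⟩
  x % suc b₁                        ≡⟨ sym ([m+kn]%n≡m%n x q (suc b₁)) ⟩
  (x + q * suc b₁) % suc b₁         ≡⟨ cong (_% suc b₁) (trans (+-comm x (q * suc b₁)) eq) ⟩
  (r * suc b₁ + y) % suc b₁         ≡⟨ cong (_% suc b₁) (+-comm (r * suc b₁) y) ⟩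
  (y + r * suc b₁) % suc b₁         ≡⟨ [m+kn]%n≡m%n y r (suc b₁) ⟩
  y % suc b₁                        ≡⟨ m<n⇒m%n≡m y<b ⟩
  y                                 ∎
  where open ≡-Reasoning

digits<square : ∀ {b₁ s t} → s ≤ b₁ → t < suc b₁ → s * suc b₁ + t < suc b₁ * suc b₁
digits<square {b₁} {s} {t} s≤b₁ t<b = begin-strict
  s * suc b₁ + t        <⟨ +-monoʳ-< (s * suc b₁) t<b ⟩
  s * suc b₁ + suc b₁   ≤⟨ +-monoˡ-≤ (suc b₁) (*-monoˡ-≤ (suc b₁) s≤b₁) ⟩
  b₁ * suc b₁ + suc b₁  ≡⟨ +-comm (b₁ * suc b₁) (suc b₁) ⟩
  suc b₁ * suc b₁       ∎
  where open ≤-Reasoning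

square≤-carry : ∀ {b₁ s t} → b₁ ≤ s → suc b₁ ≤ t → suc b₁ * suc b₁ ≤ s * suc b₁ + t
square≤-carry {b₁} {s} {t} b₁≤s b≤t = begin
  suc b₁ * suc b₁       ≡⟨ +-comm (suc b₁) (b₁ * suc b₁) ⟩
  b₁ * suc b₁ + suc b₁  ≤⟨ +-mono-≤ (*-monoˡ-≤ (suc b₁) b₁≤s) b≤t ⟩
  s * suc b₁ + t        ∎
  where open ≤-Reasoning

square≤-lead : ∀ {b s} t → b ≤ s → b * b ≤ s * b + t
square≤-lead {b} {s} t b≤s = ≤-trans (*-monoˡ-≤ b b≤s) (m≤m+n (s * b) t)

sumBelow : ℕ → (ℕ → ℕ) → ℕ
sumBelow zero    F = 0
sumBelow (suc n) F = F n + sumBelow n F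

indicator : Bool → ℕ
indicator t = if t then 1 else 0

countBelow : ℕ → (ℕ → Bool) → ℕ
countBelow n f = sumBelow n (indicator ∘ f)

sumBelow-cong : ∀ n {F G} → (∀ i → i < n → F i ≡ G i) → sumBelow n F ≡ sumBelow n G
sumBelow-cong zero    F≡G = refl
sumBelow-cong (suc n) F≡G =
  cong₂ _+_ (F≡G n ≤-refl) (sumBelow-cong n (λ i i<n → F≡G i (m≤n⇒m≤1+n i<n)))

sumBelow-suc : ∀ n F → sumBelow (suc n) F ≡ F 0 + sumBelow n (F ∘ suc)
sumBelow-suc zero    F = refl
sumBelow-suc (suc n) F = begin
  F (suc n) + sumBelow (suc n) F              ≡⟨ cong (F (suc n) +_) (sumBelow-suc n F) ⟩
  F (suc n) + (F 0 + sumBelow n (F ∘ suc))    ≡⟨ x∙yz≈y∙xz (F (suc n)) (F 0) _ ⟩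
  F 0 + (F (suc n) + sumBelow n (F ∘ suc))    ∎
  where open ≡-Reasoning

sumBelow-vanishing : ∀ {n} m F → n ≤ m → (∀ {i} → n ≤ i → F i ≡ 0) → sumBelow m F ≡ sumBelow n F
sumBelow-vanishing zero    F z≤n vanish = refl
sumBelow-vanishing (suc m) F n≤1+m vanish with m≤n⇒m<n∨m≡n n≤1+m
... | inj₂ refl        = refl
... | inj₁ (s≤s n≤m) = cong₂ _+_ (vanish n≤m) (sumBelow-vanishing m F n≤m vanish)

countRange-tabulate : ∀ {P : ℕ → Set} {lo} n {f : ℕ → Bool} →
                      (∀ i → i < n → Reflects (P (lo + i)) (f i)) → CountRange P lo n (countBelow n f)
countRange-tabulate zero        _       = nil
countRange-tabulate (suc n) {f} reflect with f n | reflect n ≤-refl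
... | true  | ofʸ p  = yes p  (countRange-tabulate n (λ i i<n → reflect i (m≤n⇒m≤1+n i<n)))
... | false | ofⁿ ¬p = no  ¬p (countRange-tabulate n (λ i i<n → reflect i (m≤n⇒m≤1+n i<n)))

countRange-append : ∀ {P : ℕ → Set} {lo n k c d} →
                    CountRange P (lo + n) k c → CountRange P lo n d → CountRange P lo (k + n) (c + d)
countRange-append             nil              r = r
countRange-append {P} {lo} {n} (yes {len} p r′) r = yes (subst P (xy∙z≈x∙zy lo n len) p) (countRange-append r′ r)
countRange-append {P} {lo} {n} (no {len} ¬p r′) r =
  no (¬p ∘ subst P (sym (xy∙z≈x∙zy lo n len))) (countRange-append r′ r)

-- trapped u x y decides whether {x,y}_b stays in the window, where u = b - 1 - x; one move of the
-- sequence takes (u, x, y) to (u - y - 1, x + y + 1, y - 1).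
trapped : ℕ → ℕ → ℕ → Bool
trapped u x zero = false
trapped u x (suc y) with compare u (suc y)
... | less _ _    = false
... | equal _     = 0 <ᵇ x
... | greater _ k = trapped k (suc (x + suc y)) y

trapped-above : ∀ {u x y} → u < y → trapped u x y ≡ false
trapped-above {u} {x} {suc y} u<y with compare u (suc y)
... | less _ _    = refl
... | equal _     = ⊥-elim (<-irrefl refl u<y)
... | greater _ k = ⊥-elim (<-asym u<y (s≤s (s≤s (m≤m+n y k))))

trapped-positive-irrelevant : ∀ u y a a′ → trapped u (suc a) y ≡ trapped u (suc a′) y
trapped-positive-irrelevant u zero    a a′ = refl
trapped-positive-irrelevant u (suc y) a a′ with compare u (suc y)
... | less _ _    = refl
... | equal _     = refl
... | greater _ k = trapped-positive-irrelevant k y _ _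

trapped-below : ∀ {u y} x x′ → y < u → trapped u x y ≡ trapped u x′ y
trapped-below {u} {zero}  x x′ y<u = refl
trapped-below {u} {suc y} x x′ y<u with compare u (suc y)
... | less _ k    = ⊥-elim (<⇒≱ y<u (m≤n⇒m≤1+n (m≤m+n u k)))
... | equal _     = ⊥-elim (<-irrefl refl y<u)
... | greater _ k = trapped-positive-irrelevant k y _ _

trapped-diagonal : ∀ {u y} x → u ≡ suc y → trapped u x (suc y) ≡ (0 <ᵇ x)
trapped-diagonal {u} {y} x u≡1+y with compare u (suc y)
... | less _ k    = ⊥-elim (<-irrefl u≡1+y (s≤s (m≤m+n u k)))
... | equal _     = refl
... | greater _ k = ⊥-elim (<-irrefl (sym u≡1+y) (s≤s (s≤s (m≤m+n y k))))

row : ℕ → ℕ → ℕ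
row b₁ x = countBelow (suc b₁) (trapped (b₁ ∸ x) x)

row-truncate : ∀ {u n} x → u < n → countBelow n (trapped u x) ≡ countBelow (suc u) (trapped u x)
row-truncate {n = n} x u<n =
  sumBelow-vanishing n _ u<n (λ u<i → cong indicator (trapped-above u<i))

row-positive-irrelevant : ∀ {u n n′} a a′ → u < n → u < n′ →
                          countBelow n (trapped u (suc a)) ≡ countBelow n′ (trapped u (suc a′))
row-positive-irrelevant {u} {n} {n′} a a′ u<n u<n′ = begin
  countBelow n (trapped u (suc a))        ≡⟨ row-truncate (suc a) u<n ⟩
  countBelow (suc u) (trapped u (suc a))  ≡⟨ sumBelow-cong (suc u) (λ i _ →
                                               cong indicator (trapped-positive-irrelevant u i a a′)) ⟩
  countBelow (suc u) (trapped u (suc a′)) ≡⟨ row-truncate (suc a′) u<n′ ⟨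
  countBelow n′ (trapped u (suc a′))      ∎
  where open ≡-Reasoning

row-sum-difference : ∀ b₀ →
  sumBelow (3 + b₀) (row (2 + b₀)) ≡ sumBelow (2 + b₀) (row (1 + b₀)) + (1 + countBelow (1 + b₀) (trapped (2 + b₀) 0 ∘ suc))
row-sum-difference b₀ = begin
  sumBelow (suc β) (row β)                                   ≡⟨ sumBelow-suc β (row β) ⟩
  row β 0 + sumBelow β (row β ∘ suc)                         ≡⟨ cong (row β 0 +_) (sumBelow-suc β′ (row β ∘ suc)) ⟩
  row β 0 + (row β 1 + sumBelow β′ (row β ∘ suc ∘ suc))      ≡⟨ cong₂ _+_ row-β-0 (cong₂ _+_ row-β-1 inner-rows) ⟩
  c + (1 + X + R)                                            ≡⟨ rearrange c X R ⟩
  X + R + (1 + c)                                            ≡⟨ cong (λ r → r + R + (1 + c)) row-β′-0 ⟨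
  row β′ 0 + R + (1 + c)                                     ≡⟨ cong (_+ (1 + c)) (sumBelow-suc β′ (row β′)) ⟨
  sumBelow β (row β′) + (1 + c)                              ∎
  where
  open ≡-Reasoning
  β′ = suc b₀
  β  = suc β′
  c = countBelow β′ (trapped β 0 ∘ suc)
  X = countBelow β′ (trapped β′ 0)
  R = sumBelow β′ (row β′ ∘ suc)
  rearrange : ∀ c X R → c + (1 + X + R) ≡ X + R + (1 + c)
  rearrange = solve-∀
  row-β-0 : row β 0 ≡ c
  row-β-0 = begin
    row β 0                     ≡⟨ cong (λ t → indicator t + countBelow β (trapped β 0)) (trapped-diagonal {y = β′} 0 refl) ⟩
    countBelow β (trapped β 0)  ≡⟨ sumBelow-suc β′ (indicator ∘ trapped β 0) ⟩
    c                           ∎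
  row-β-1 : row β 1 ≡ 1 + X
  row-β-1 = begin
    row β 1                          ≡⟨ row-truncate {β′} 1 (m≤n⇒m≤1+n (n<1+n β′)) ⟩
    countBelow (suc β′) (trapped β′ 1) ≡⟨ cong₂ _+_ (cong indicator (trapped-diagonal {y = b₀} 1 refl))
                                            (sumBelow-cong β′ (λ i i<β′ → cong indicator (trapped-below 1 0 i<β′))) ⟩
    1 + X                            ∎
  row-β′-0 : row β′ 0 ≡ X
  row-β′-0 = cong (λ t → indicator t + X) (trapped-diagonal {y = b₀} 0 refl)
  inner-rows : sumBelow β′ (row β ∘ suc ∘ suc) ≡ R
  inner-rows = sumBelow-cong β′ λ x _ →
    row-positive-irrelevant (suc x) x (s≤s (≤-trans (m∸n≤m b₀ x) (m≤n+m b₀ 2))) (s≤s (≤-trans (m∸n≤m b₀ x) (n≤1+n b₀)))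

module Window (b₁ m₁ : ℕ) (1≤b₁ : 1 ≤ b₁) (2≤m₁ : 2 ≤ m₁) where

  b M N L : ℕ
  b = suc b₁
  M = suc m₁
  N = b ^ M
  L = N ∸ b ^ 2

  b^2≡b*b : b ^ 2 ≡ b * b
  b^2≡b*b = cong (b *_) (*-identityʳ b)

  b^2≤N : b ^ 2 ≤ N
  b^2≤N = ^-monoʳ-≤ b (≤-trans 2≤m₁ (n≤1+n m₁))

  b*b≤N : b * b ≤ N
  b*b≤N = subst (_≤ N) b^2≡b*b b^2≤N

  L+b*b≡N : L + b * b ≡ N
  L+b*b≡N = subst (λ s → N ∸ b ^ 2 + s ≡ N) b^2≡b*b (m∸n+n≡m b^2≤N)

  b₁*b^m₁≤L : b₁ * b ^ m₁ ≤ L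
  b₁*b^m₁≤L = m+n≤o⇒m≤o∸n (b₁ * b ^ m₁)
    (subst (b₁ * b ^ m₁ + b ^ 2 ≤_) (+-comm (b₁ * b ^ m₁) (b ^ m₁)) (+-monoʳ-≤ (b₁ * b ^ m₁) (^-monoʳ-≤ b 2≤m₁)))

  1≤L+ : ∀ r → 1 ≤ L + r
  1≤L+ r = ≤-trans (≤-trans (*-mono-≤ 1≤b₁ (m^n>0 b m₁)) b₁*b^m₁≤L) (m≤m+n L r)

  msd-inner : ∀ {r} → r < b * b → IsMSD b (L + r) b₁
  msd-inner {r} r<b*b = inj₂ (1≤b₁ , n<1+n b₁ , m₁ , ≤-trans b₁*b^m₁≤L (m≤m+n L r) ,
                              subst (L + r <_) L+b*b≡N (+-monoʳ-< L r<b*b))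

  msd-outer : ∀ {r} → b * b ≤ r → r < b * b + N → IsMSD b (L + r) 1
  msd-outer {r} b*b≤r r<b*b+N = inj₂ (≤-refl , s≤s 1≤b₁ , M ,
    subst (_≤ L + r) (trans L+b*b≡N (sym (*-identityˡ N))) (+-monoʳ-≤ L b*b≤r) ,
    subst (L + r <_) (trans (sym (+-assoc L (b * b) N)) (cong₂ _+_ L+b*b≡N (sym (+-identityʳ N)))) (+-monoʳ-< L r<b*b+N))

  msd-inner-unique : ∀ {r z} → r < b * b → IsMSD b (L + r) z → z ≡ b₁
  msd-inner-unique r<b*b msd = msd-unique (1≤L+ _) msd (msd-inner r<b*b)

  msd-outer-unique : ∀ {r z} → b * b ≤ r → r < b * b + N → IsMSD b (L + r) z → z ≡ 1
  msd-outer-unique b*b≤r r<b*b+N msd = msd-unique (1≤L+ _) msd (msd-outer b*b≤r r<b*b+N)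

  offset : ℕ → ℕ → ℕ
  offset x y = x * b + y

  step-offset : ℕ → ℕ → ℕ → ℕ
  step-offset x y z = offset x y + offset y z

  offset<b*b : ∀ {x y} → x < b → y < b → offset x y < b * b
  offset<b*b x<b y<b = digits<square (≤-pred x<b) y<b

  brace≡ : ∀ x y → brace b M x y ≡ L + offset x y
  brace≡ x y = +-assoc L (x * b) y

  brace<N : ∀ x y → offset x y < b * b → brace b M x y < N
  brace<N x y fits = subst₂ _<_ (sym (brace≡ x y)) L+b*b≡N (+-monoʳ-< L fits)

  brace-successor≡ : ∀ x y z → brace b M x y + b * y + z ≡ L + step-offset x y z
  brace-successor≡ x y z = regroup L x y z b
    where regroup : ∀ L x y z b → L + x * b + y + b * y + z ≡ L + (x * b + y + (y * b + z))
          regroup = solve-∀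

  step-offset≡ : ∀ x y z → step-offset x y z ≡ (x + y) * b + (y + z)
  step-offset≡ x y z = regroup x y z b
    where regroup : ∀ x y z b → x * b + y + (y * b + z) ≡ (x + y) * b + (y + z)
          regroup = solve-∀

  step-offset-mono : ∀ x y {z z′} → z ≤ z′ → step-offset x y z ≤ step-offset x y z′
  step-offset-mono x y z≤z′ = +-monoʳ-≤ (offset x y) (+-monoʳ-≤ (y * b) z≤z′)

  lsd-brace : ∀ x {y} → y < b → IsLSD b (brace b M x y) y
  lsd-brace x {y} y<b = y<b , Q + x , (begin
    L + x * b + y      ≡⟨ cong (λ l → l + x * b + y) (*-distribˡ-∸ b (b ^ m₁) (b ^ 1)) ⟨
    b * Q + x * b + y  ≡⟨ regroup Q x y b ⟩
    (Q + x) * b + y    ∎)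
    where
    open ≡-Reasoning
    Q = b ^ m₁ ∸ b ^ 1
    regroup : ∀ Q x y b → b * Q + x * b + y ≡ (Q + x) * b + y
    regroup = solve-∀

  step-from-brace : ∀ x y {z} → y < b → z < b → IsMSD b (L + step-offset x y z) z →
                    (∀ z′ → z′ < z → ¬ IsMSD b (L + step-offset x y z′) z′) →
                    Step b (brace b M x y) (L + step-offset x y z)
  step-from-brace x y {z} y<b z<b msd least =
    y , z , lsd-brace x y<b , z<b , subst (λ v → IsMSD b v z) (sym (brace-successor≡ x y z)) msd ,
    (λ z′ z′<z → subst (λ v → ¬ IsMSD b v z′) (sym (brace-successor≡ x y z′)) (least z′ z′<z)) ,
    sym (brace-successor≡ x y z)

  step-from-brace-inversion : ∀ {x y a} → y < b → Step b (brace b M x y) a →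
                     ∃ λ z → z < b × IsMSD b (L + step-offset x y z) z × a ≡ L + step-offset x y z
  step-from-brace-inversion {x} y<b (y′ , z , lsd , z<b , msd , _ , refl) with lsd-unique lsd (lsd-brace x y<b)
  ... | refl = z , z<b , subst (λ v → IsMSD b v z) (brace-successor≡ x y′ z) msd , brace-successor≡ x y′ z

  brace-escapes : ∀ x y → x < b → y < b → b * b ≤ step-offset x y 1 → ¬ NoEscape b M (brace b M x y)
  brace-escapes x y x<b y<b b*b≤ = escape-now {m = M} (step-from-brace x y y<b 1<b msd least) N≤
    where
    1<b : 1 < b
    1<b = s≤s 1≤b₁
    msd : IsMSD b (L + step-offset x y 1) 1
    msd = msd-outer b*b≤ (+-mono-<-≤ (offset<b*b x<b y<b) (<⇒≤ (<-≤-trans (offset<b*b y<b 1<b) b*b≤N)))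
    least : ∀ z′ → z′ < 1 → ¬ IsMSD b (L + step-offset x y z′) z′
    least zero    _          = msd-nonzero (1≤L+ _)
    least (suc _) (s≤s ())
    N≤ : b ^ M ≤ L + step-offset x y 1
    N≤ = subst (_≤ L + step-offset x y 1) L+b*b≡N (+-monoʳ-≤ L b*b≤)

  brace-advances : ∀ x y {x′ y′ β} → y < b → x′ < b → y′ < b → step-offset x y b₁ ≡ offset x′ y′ →
                   Reflects (NoEscape b M (brace b M x′ y′)) β → Reflects (NoEscape b M (brace b M x y)) β
  brace-advances x y {x′} {y′} {β} y<b x′<b y′<b lands stays′ =
    noEscape-advance {m = M} (brace<N x y (≤-<-trans (m≤m+n (offset x y) (offset y b₁)) fits)) step deterministic
      (subst (λ v → Reflects (NoEscape b M v) β) (trans (brace≡ x′ y′) (cong (L +_) (sym lands))) stays′)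
    where
    fits : step-offset x y b₁ < b * b
    fits = subst (_< b * b) (sym lands) (offset<b*b x′<b y′<b)
    inner : ∀ {z} → z ≤ b₁ → step-offset x y z < b * b
    inner z≤b₁ = ≤-<-trans (step-offset-mono x y z≤b₁) fits
    step : Step b (brace b M x y) (L + step-offset x y b₁)
    step = step-from-brace x y y<b (n<1+n b₁) (msd-inner fits)
             (λ z′ z′<b₁ msd → <-irrefl (msd-inner-unique (inner (<⇒≤ z′<b₁)) msd) z′<b₁)
    deterministic : ∀ a → Step b (brace b M x y) a → a ≡ L + step-offset x y b₁
    deterministic a st with step-from-brace-inversion {x} y<b st
    ... | z , z<b , msd , refl = cong (λ z → L + step-offset x y z) (msd-inner-unique (inner (≤-pred z<b)) msd)

  brace-halts : ∀ x y → x < b → y < b → step-offset x y 1 < b * b → b * b ≤ step-offset x y b₁ →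
                NoEscape b M (brace b M x y)
  brace-halts x y x<b y<b below above = noEscape-halt {m = M} (brace<N x y (offset<b*b x<b y<b)) no-step
    where
    no-step : ∀ a → ¬ Step b (brace b M x y) a
    no-step a st with step-from-brace-inversion {x} y<b st
    ... | zero , _ , msd , _ = msd-nonzero (1≤L+ _) msd
    ... | suc z , z<b , msd , _ with <-≤-connex (step-offset x y (suc z)) (b * b)
    ...   | inj₁ inner = <⇒≱ (subst (λ w → step-offset x y w < b * b) (msd-inner-unique inner msd) inner) above
    ...   | inj₂ outer = <⇒≱ (subst (λ w → step-offset x y w < b * b) (sym (msd-outer-unique outer upper msd)) below) outer
      where
      upper : step-offset x y (suc z) < b * b + N
      upper = +-mono-<-≤ (offset<b*b x<b y<b) (<⇒≤ (<-≤-trans (offset<b*b y<b z<b) b*b≤N))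

  summand<b : ∀ x u → x + u ≡ b₁ → x < b
  summand<b x u x+u≡b₁ = s≤s (m+n≤o⇒m≤o x (≤-reflexive x+u≡b₁))

  last-digit-escapes : ∀ {x} → x < b → ¬ NoEscape b M (brace b M x b₁)
  last-digit-escapes {x} x<b = brace-escapes x b₁ x<b (n<1+n b₁)
    (subst (b * b ≤_) (sym (step-offset≡ x b₁ 1)) (square≤-carry (m≤n+m b₁ x) (≤-reflexive (+-comm 1 b₁))))

  diagonal-reflects : ∀ x {y} → x + suc y ≡ b₁ → Reflects (NoEscape b M (brace b M x (suc y))) (0 <ᵇ x)
  diagonal-reflects zero    x+y≡b₁ =
    ofⁿ (subst (λ d → ¬ NoEscape b M (brace b M 0 d)) (sym x+y≡b₁) (last-digit-escapes (s≤s z≤n)))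
  diagonal-reflects (suc a) {y} x+y≡b₁ =
    ofʸ (brace-halts (suc a) (suc y) (summand<b (suc a) (suc y) x+y≡b₁) (<-trans y<b₁ (n<1+n b₁)) below above)
    where
    y<b₁ : suc y < b₁
    y<b₁ = subst (suc (suc y) ≤_) x+y≡b₁ (+-monoˡ-≤ (suc y) (s≤s z≤n))
    below : step-offset (suc a) (suc y) 1 < b * b
    below = subst (_< b * b) (sym (step-offset≡ (suc a) (suc y) 1))
              (digits<square (≤-reflexive x+y≡b₁) (s≤s (subst (_≤ b₁) (+-comm 1 (suc y)) y<b₁)))
    above : b * b ≤ step-offset (suc a) (suc y) b₁
    above = subst (b * b ≤_) (sym (step-offset≡ (suc a) (suc y) b₁))
              (square≤-carry (≤-reflexive (sym x+y≡b₁)) (s≤s (m≤n+m b₁ y)))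

  trapped-reflects : ∀ y x u → x + u ≡ b₁ → y < b → Reflects (NoEscape b M (brace b M x y)) (trapped u x y)
  trapped-reflects zero x u x+u≡b₁ _ =
    brace-advances x 0 (s≤s z≤n) x<b (n<1+n b₁) (cong (_+ b₁) (+-identityʳ (x * b)))
      (ofⁿ (last-digit-escapes x<b))
    where x<b = summand<b x u x+u≡b₁
  trapped-reflects (suc y) x u x+u≡b₁ y<b with compare u (suc y)
  ... | less _ k    = ofⁿ (brace-escapes x (suc (u + k)) (summand<b x u x+u≡b₁) y<b
    (subst (b * b ≤_) (sym (step-offset≡ x (suc (u + k)) 1)) (square≤-lead (suc (u + k) + 1) b≤x+y)))
    where
    b≤x+y : b ≤ x + suc (u + k)
    b≤x+y = subst (λ c → suc c ≤ x + suc (u + k)) x+u≡b₁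
              (≤-trans (≤-reflexive (sym (+-suc x u))) (+-monoʳ-≤ x (s≤s (m≤m+n u k))))
  ... | equal _     = diagonal-reflects x x+u≡b₁
  ... | greater _ k =
    brace-advances x (suc y) y<b (summand<b x′ k x′+k≡b₁) y′<b (carry x y b₁) (trapped-reflects y x′ k x′+k≡b₁ y′<b)
    where
    x′ = suc (x + suc y)
    y′<b = <-trans (n<1+n y) y<b
    shuffle : ∀ x y k → suc (x + suc y) + k ≡ x + suc (suc y + k)
    shuffle = solve-∀
    x′+k≡b₁ : x′ + k ≡ b₁
    x′+k≡b₁ = trans (shuffle x y k) x+u≡b₁
    carry : ∀ x y b₁ → x * suc b₁ + suc y + (suc y * suc b₁ + b₁) ≡ suc (x + suc y) * suc b₁ + y
    carry = solve-∀

  1≤brace : ∀ x y → 1 ≤ brace b M x y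
  1≤brace x y = subst (1 ≤_) (sym (brace≡ x y)) (1≤L+ (offset x y))

  Counted : ℕ → Set
  Counted v = 1 ≤ v × NoEscape b M v

  rows-count : ∀ x → x ≤ b → CountRange Counted L (x * b) (sumBelow x (row b₁))
  rows-count zero    _   = nil
  rows-count (suc x) x<b = countRange-append
    (countRange-tabulate b λ y y<b →
      ofʸ (1≤brace x y) ×-reflects trapped-reflects y x (b₁ ∸ x) (m+[n∸m]≡n (≤-pred x<b)) y<b)
    (rows-count x (<⇒≤ x<b))

  D-count : Dcount b M (sumBelow b (row b₁))
  D-count = subst (λ n → CountRange Counted L n (sumBelow b (row b₁))) (sym b^2≡b*b) (rows-count b ≤-refl)

  left-column-count : CountRange (λ d → NoEscape b M (brace b M 0 d)) 1 (b₁ ∸ 1)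
                                 (countBelow (b₁ ∸ 1) (trapped b₁ 0 ∘ suc))
  left-column-count = countRange-tabulate (b₁ ∸ 1) λ d d<b₁-1 →
    trapped-reflects (suc d) 0 b₁ refl (s≤s (≤-trans d<b₁-1 (m∸n≤m b₁ 1)))

lemma4 : (b m : ℕ) → b ≥ 3 → m ≥ 3 →
    Σ ℕ λ Db → Σ ℕ λ Db₁ → Σ ℕ λ c →
    Dcount b m Db
    × Dcount (b ∸ 1) m Db₁
    × CountRange (λ d → NoEscape b m (brace b m 0 d)) 1 (b ∸ 2) c
    × Db ≡ Db₁ + (1 + c)
lemma4 (suc (suc (suc b₀))) (suc m₁@(suc (suc _))) (s≤s (s≤s (s≤s _))) (s≤s (s≤s (s≤s _))) =
  _ , _ , _ , base-b.D-count , base-b-1.D-count , base-b.left-column-count , row-sum-difference b₀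
  where
  module base-b   = Window (suc (suc b₀)) m₁ (s≤s z≤n) (s≤s (s≤s z≤n))
  module base-b-1 = Window (suc b₀) m₁ (s≤s z≤n) (s≤s (s≤s z≤n))
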